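{- Let $\mathcal{A}=(Q,q_I,\delta,F)$ be a deterministic one-counter automaton with infinite run $(q_0,n_0)(q_1,n_1)\cdots$, and let $K_1,K_2,K_{inc}\in\mathbb{N}$ satisfy $K_1+K_2\le|Q|^3$, $K_{inc}\le|Q|$ and $(q_{i+K_2},n_{i+K_2})=(q_i,n_i+K_{inc})$ for all $i\ge K_1$. Suppose $K_{inc}>0$. Let $\beta_1,\beta_2\ge0$ be the smallest natural numbers such that $n_i\in[n_{K_1}-\beta_1,n_{K_1}+\beta_2]$ for every $i\in[K_1,K_1+K_2-1]$, let $\gamma$ be the greatest value among $\{n_0,\dots,n_{K_1-1}\}$, and let $L=1+\gamma+\lceil(\beta_1+\beta_2)/K_{inc}\rceil$. Then for all $i,j\in\mathbb{N}$: (1) if $i,j\ge K_1$ and $|i-j|\ge LK_2$ then $n_i\ne n_j$; (2) if $i<K_1$ and $j\ge K_1+LK_2$ then $n_i\ne n_j$.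
   Context: A one-counter automaton is a tuple $\mathcal{A}=(Q,q_I,\delta,F)$ with $Q$ finite, $q_I\in Q$, $F\subseteq Q$, $\delta\subseteq Q\times\{\mathtt{inc},\mathtt{dec},\mathtt{ifzero}\}\times Q$. Configurations are $(q,n)\in Q\times\mathbb{N}$; $(q,n)\to(q',n')$ iff $(q,\mathtt{inc},q')\in\delta$ and $n'=n+1$, or $(q,\mathtt{dec},q')\in\delta$ and $n'=n-1\ge0$, or $(q,\mathtt{ifzero},q')\in\delta$ and $n=n'=0$. A run is a finite or infinite sequence of configurations starting at $(q_I,0)$ with consecutive ones related by $\to$. $\mathcal{A}$ is deterministic if for every state $q$: either exactly one transition leaves $q$ and it is labelled $\mathtt{inc}$, or exactly two leave $q$, one labelled $\mathtt{ifzero}$ and one $\mathtt{dec}$, or none leaves $q$; hence its infinite run, if any, is unique. -}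

module Defs where

open import Data.Nat using (ℕ; zero; suc; _+_; _∸_; _⊔_; _/_)
open import Data.Fin using (Fin)
open import Data.Product using (_×_; _,_; ∃-syntax)
open import Data.Sum using (_⊎_)
open import Relation.Binary.PropositionalEquality using (_≡_)
open import Relation.Nullary using (¬_)

data Op : Set where
  inc dec ifzero : Op

-- A one-counter automaton with state set Q = Fin m (so |Q| = m).
-- δ is the transition relation, given as a predicate on Q × Op × Q;
-- F is the set of accepting states, given as a predicate on Q.
record OCA (m : ℕ) : Set₁ where
  field
    qI : Fin m
    δ  : Fin m → Op → Fin m → Set
    F  : Fin m → Set
open OCA public

Config : ℕ → Set
Config m = Fin m × ℕ

data Step {m : ℕ} (A : OCA m) : Config m → Config m → Set where
  step-inc    : ∀ {q q' n} → δ A q inc q'    → Step A (q , n) (q' , suc n)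
  step-dec    : ∀ {q q' n} → δ A q dec q'    → Step A (q , suc n) (q' , n)
  step-ifzero : ∀ {q q'}   → δ A q ifzero q' → Step A (q , 0) (q' , 0)

Deterministic : {m : ℕ} → OCA m → Set
Deterministic {m} A = (q : Fin m) →
    (∃[ q' ] (δ A q inc q' ×
        (∀ a q'' → δ A q a q'' → (a ≡ inc × q'' ≡ q'))))
  ⊎ (∃[ q₁ ] ∃[ q₂ ] (δ A q ifzero q₁ × δ A q dec q₂ ×
        (∀ a q'' → δ A q a q'' → ((a ≡ ifzero × q'' ≡ q₁) ⊎ (a ≡ dec × q'' ≡ q₂)))))
  ⊎ (∀ a q' → ¬ δ A q a q')

IsInfiniteRun : {m : ℕ} → OCA m → (ℕ → Config m) → Set
IsInfiniteRun A ρ = (ρ 0 ≡ (qI A , 0)) × (∀ i → Step A (ρ i) (ρ (suc i)))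

-- maxBelow f k = max { f 0, ..., f (k-1) }, with the convention 0 for k = 0.
maxBelow : (ℕ → ℕ) → ℕ → ℕ
maxBelow f zero    = 0
maxBelow f (suc k) = maxBelow f k ⊔ f k

-- Ceiling division ⌈ a / k ⌉ (for k > 0; value 0 for k = 0, never used).
ceilDiv : ℕ → ℕ → ℕ
ceilDiv a zero    = 0
ceilDiv a (suc k) = (a + k) / suc k

-- After K₁ the counter values repeat every K₂ steps, shifted up by Kinc > 0. Hence
-- the value at step K₁ + r + t K₂ (r < K₂) lies in the window [X, X + β₁ + β₂]
-- raised by t Kinc, where X = n_{K₁} − β₁. A later step can therefore undershoot
-- an earlier one by at most β₁ + β₂, and L K₂ steps add L Kinc > β₁ + β₂ to the
-- counter, so values L K₂ apart differ. Steps ≥ K₁ + L K₂ also carry at least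
-- L Kinc ≥ L > γ, above every value before K₁.
module Submission where

open import Defs
open import Data.Nat
  using (ℕ; zero; suc; _+_; _∸_; _*_; _^_; _≤_; _<_; _≥_; ∣_-_∣; _/_; _%_; s≤s; NonZero; >-nonZero; >-nonZero⁻¹)
open import Data.Nat.Properties
open import Data.Nat.DivMod using (m≡m%n+[m/n]*n; m%n<n; /-monoˡ-≤)
open import Algebra.Properties.CommutativeSemigroup +-commutativeSemigroup
  using (xy∙z≈xz∙y; x∙yz≈yx∙z)
open import Data.Product using (_×_; _,_; proj₁; proj₂)
open import Data.Sum using (inj₁; inj₂)
open import Relation.Nullary using (contradiction)
open import Relation.Binary.PropositionalEquality
  using (_≡_; _≢_; refl; sym; trans; cong; module ≡-Reasoning)

≤-maxBelow : ∀ (f : ℕ → ℕ) {k i} → i < k → f i ≤ maxBelow f k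
≤-maxBelow f {suc k} (s≤s i≤k) with m≤n⇒m<n∨m≡n i≤k
... | inj₁ i<k  = ≤-trans (≤-maxBelow f i<k) (m≤m⊔n (maxBelow f k) (f k))
... | inj₂ refl = m≤n⊔m (maxBelow f k) (f k)

≤-ceilDiv* : ∀ a k .{{_ : NonZero k}} → a ≤ ceilDiv a k * k
≤-ceilDiv* a (suc k) = +-cancelʳ-≤ k a _ (begin
  a + k                          ≡⟨ m≡m%n+[m/n]*n (a + k) (suc k) ⟩
  (a + k) % suc k + q * suc k    ≤⟨ +-monoˡ-≤ _ (≤-pred (m%n<n (a + k) (suc k))) ⟩
  k + q * suc k                  ≡⟨ +-comm k _ ⟩
  q * suc k + k                  ∎)
  where
  open ≤-Reasoning
  q : ℕ
  q = (a + k) / suc k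

<-[1+m+ceilDiv]* : ∀ a k m .{{_ : NonZero k}} → a < (1 + m + ceilDiv a k) * k
<-[1+m+ceilDiv]* a k m = begin-strict
  a                 ≤⟨ ≤-ceilDiv* a k ⟩
  c * k             <⟨ m<n+m (c * k) (>-nonZero⁻¹ k) ⟩
  suc c * k         ≤⟨ *-monoˡ-≤ k (s≤s (m≤n+m c m)) ⟩
  (1 + m + c) * k   ∎
  where
  open ≤-Reasoning
  c : ℕ
  c = ceilDiv a k

m+n≤[m∸o]+[o+n] : ∀ m n o → m + n ≤ (m ∸ o) + (o + n)
m+n≤[m∸o]+[o+n] m n o = begin
  m + n             ≤⟨ +-monoˡ-≤ n (m≤n+m∸n m o) ⟩
  o + (m ∸ o) + n   ≡⟨ sym (x∙yz≈yx∙z (m ∸ o) o n) ⟩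
  (m ∸ o) + (o + n) ∎
  where open ≤-Reasoning

m≤n∧o≤∣m-n∣⇒m+o≤n : ∀ {m n o} → m ≤ n → o ≤ ∣ m - n ∣ → m + o ≤ n
m≤n∧o≤∣m-n∣⇒m+o≤n {m} {n} {o} m≤n o≤∣m-n∣ = begin
  m + o           ≤⟨ +-monoʳ-≤ m o≤∣m-n∣ ⟩
  m + ∣ m - n ∣   ≡⟨ cong (m +_) (m≤n⇒∣m-n∣≡n∸m m≤n) ⟩
  m + (n ∸ m)     ≡⟨ m+[n∸m]≡n m≤n ⟩
  n               ∎
  where open ≤-Reasoning

far-apart-≢ : ∀ (f : ℕ → ℕ) (K d : ℕ) →
  (∀ {i j} → K ≤ i → i + d ≤ j → f i < f j) →
  ∀ {i j} → K ≤ i → K ≤ j → d ≤ ∣ i - j ∣ → f i ≢ f j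
far-apart-≢ f K d increase {i} {j} K≤i K≤j d≤∣i-j∣ with ≤-total i j
... | inj₁ i≤j = <⇒≢ (increase K≤i (m≤n∧o≤∣m-n∣⇒m+o≤n i≤j d≤∣i-j∣))
... | inj₂ j≤i = λ fi≡fj → <⇒≢ (increase K≤j
  (m≤n∧o≤∣m-n∣⇒m+o≤n j≤i (≤-trans d≤∣i-j∣ (≤-reflexive (∣-∣-comm i j))))) (sym fi≡fj)

module EventuallyPeriodic (N : ℕ → ℕ) {K₁ K₂ Kinc : ℕ}
  (shift : ∀ i → K₁ ≤ i → N (i + K₂) ≡ N i + Kinc) where

  shift-iterate : ∀ t {i} → K₁ ≤ i → N (i + t * K₂) ≡ N i + t * Kinc
  shift-iterate zero    {i} _   = trans (cong N (+-identityʳ i)) (sym (+-identityʳ (N i)))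
  shift-iterate (suc t) {i} K₁≤i = begin
    N (i + (K₂ + t * K₂))      ≡⟨ cong N (trans (sym (+-assoc i K₂ _)) (xy∙z≈xz∙y i K₂ _)) ⟩
    N (i + t * K₂ + K₂)        ≡⟨ shift _ (≤-trans K₁≤i (m≤m+n i _)) ⟩
    N (i + t * K₂) + Kinc      ≡⟨ cong (_+ Kinc) (shift-iterate t K₁≤i) ⟩
    N i + t * Kinc + Kinc      ≡⟨ trans (xy∙z≈xz∙y (N i) _ Kinc) (+-assoc (N i) Kinc _) ⟩
    N i + (Kinc + t * Kinc)    ∎
    where open ≡-Reasoning

  N-unshift : ∀ t {j} → K₁ + t * K₂ ≤ j → N j ≡ N (j ∸ t * K₂) + t * Kinc
  N-unshift t {j} le = trans
    (cong N (sym (m∸n+n≡m (m+n≤o⇒n≤o K₁ le))))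
    (shift-iterate t (m+n≤o⇒m≤o∸n K₁ le))

  *-≤-late : ∀ t {j} → K₁ + t * K₂ ≤ j → t * Kinc ≤ N j
  *-≤-late t {j} le = ≤-trans (m≤n+m (t * Kinc) _) (≤-reflexive (sym (N-unshift t le)))

  module _ .{{_ : NonZero K₂}} where

    phase lap : ℕ → ℕ
    phase i = (i ∸ K₁) % K₂
    lap   i = (i ∸ K₁) / K₂

    N≡phase+lap : ∀ {i} → K₁ ≤ i → N i ≡ N (K₁ + phase i) + lap i * Kinc
    N≡phase+lap {i} K₁≤i = trans (cong N index≡) (shift-iterate (lap i) (m≤m+n K₁ _))
      where
      index≡ : i ≡ K₁ + phase i + lap i * K₂
      index≡ = trans (sym (m+[n∸m]≡n K₁≤i))
        (trans (cong (K₁ +_) (m≡m%n+[m/n]*n (i ∸ K₁) K₂)) (sym (+-assoc K₁ _ _)))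

    module _ (X w : ℕ)
      (window : ∀ r → r < K₂ → X ≤ N (K₁ + r) × N (K₁ + r) ≤ X + w) where

      drift-≤ : ∀ {i j} → K₁ ≤ i → i ≤ j → N i ≤ N j + w
      drift-≤ {i} {j} K₁≤i i≤j = begin
        N i                                  ≡⟨ N≡phase+lap K₁≤i ⟩
        N (K₁ + phase i) + lap i * Kinc      ≤⟨ +-mono-≤ (proj₂ (window-at i)) lap-mono ⟩
        X + w + lap j * Kinc                 ≡⟨ xy∙z≈xz∙y X w _ ⟩
        X + lap j * Kinc + w                 ≤⟨ +-monoˡ-≤ w (+-monoˡ-≤ _ (proj₁ (window-at j))) ⟩
        N (K₁ + phase j) + lap j * Kinc + w  ≡⟨ cong (_+ w) (sym (N≡phase+lap (≤-trans K₁≤i i≤j))) ⟩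
        N j + w                              ∎
        where
        open ≤-Reasoning
        window-at : ∀ k → X ≤ N (K₁ + phase k) × N (K₁ + phase k) ≤ X + w
        window-at k = window (phase k) (m%n<n (k ∸ K₁) K₂)
        lap-mono : lap i * Kinc ≤ lap j * Kinc
        lap-mono = *-monoˡ-≤ Kinc (/-monoˡ-≤ K₂ (∸-monoˡ-≤ K₁ i≤j))

      separated-< : ∀ t → w < t * Kinc → ∀ {i j} → K₁ ≤ i → i + t * K₂ ≤ j → N i < N j
      separated-< t w<tKinc {i} {j} K₁≤i le = begin-strict
        N i                              ≤⟨ drift-≤ K₁≤i (m+n≤o⇒m≤o∸n i le) ⟩
        N (j ∸ t * K₂) + w               <⟨ +-monoʳ-< _ w<tKinc ⟩
        N (j ∸ t * K₂) + t * Kinc        ≡⟨ sym (N-unshift t (≤-trans (+-monoˡ-≤ _ K₁≤i) le)) ⟩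
        N j                              ∎
        where open ≤-Reasoning

period-nonZero : ∀ (N : ℕ → ℕ) {K₁ K₂ Kinc} → 0 < Kinc →
  N (K₁ + K₂) ≡ N K₁ + Kinc → NonZero K₂
period-nonZero N {K₁} {zero} 0<Kinc eq =
  contradiction (trans (cong N (sym (+-identityʳ K₁))) eq) (<⇒≢ (m<m+n (N K₁) 0<Kinc))
period-nonZero N {K₂ = suc _} _ _ = _

lemma6 : {m : ℕ} (A : OCA m) → Deterministic A →
    (ρ : ℕ → Config m) → IsInfiniteRun A ρ →
    (K₁ K₂ Kinc : ℕ) → K₁ + K₂ ≤ m ^ 3 → Kinc ≤ m →
    (∀ i → i ≥ K₁ → ρ (i + K₂) ≡ (proj₁ (ρ i) , proj₂ (ρ i) + Kinc)) →
    0 < Kinc →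
    (β₁ β₂ : ℕ) →
    (∀ i → K₁ ≤ i → i < K₁ + K₂ →
       (proj₂ (ρ K₁) ∸ β₁ ≤ proj₂ (ρ i)) × (proj₂ (ρ i) ≤ proj₂ (ρ K₁) + β₂)) →
    (∀ b₁ b₂ → (∀ i → K₁ ≤ i → i < K₁ + K₂ →
       (proj₂ (ρ K₁) ∸ b₁ ≤ proj₂ (ρ i)) × (proj₂ (ρ i) ≤ proj₂ (ρ K₁) + b₂)) →
       (β₁ ≤ b₁) × (β₂ ≤ b₂)) →
    let n = λ i → proj₂ (ρ i)
        γ = maxBelow n K₁
        L = 1 + γ + ceilDiv (β₁ + β₂) Kinc
    in (∀ i j → i ≥ K₁ → j ≥ K₁ → ∣ i - j ∣ ≥ L * K₂ → n i ≢ n j)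
     × (∀ i j → i < K₁ → j ≥ K₁ + L * K₂ → n i ≢ n j)
lemma6 A _ ρ _ K₁ K₂ Kinc _ _ periodic 0<Kinc β₁ β₂ bounds _ =
    (λ i j → far-apart-≢ N K₁ (L * K₂)
               (separated-< X w window L (<-[1+m+ceilDiv]* w Kinc γ)))
  , (λ i j i<K₁ late → <⇒≢ (begin-strict
       N i        ≤⟨ ≤-maxBelow N i<K₁ ⟩
       γ          <⟨ s≤s (m≤m+n γ _) ⟩
       L          ≤⟨ m≤m*n L Kinc ⟩
       L * Kinc   ≤⟨ *-≤-late L late ⟩
       N j        ∎))
  where
  open ≤-Reasoning
  N : ℕ → ℕ
  N i = proj₂ (ρ i)
  γ w L X : ℕ
  γ = maxBelow N K₁
  w = β₁ + β₂
  L = 1 + γ + ceilDiv w Kinc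
  X = N K₁ ∸ β₁
  instance
    Kinc≢0 : NonZero Kinc
    Kinc≢0 = >-nonZero 0<Kinc
  shift : ∀ i → K₁ ≤ i → N (i + K₂) ≡ N i + Kinc
  shift i K₁≤i = cong proj₂ (periodic i K₁≤i)
  instance
    K₂≢0 : NonZero K₂
    K₂≢0 = period-nonZero N 0<Kinc (shift K₁ ≤-refl)
  open EventuallyPeriodic N shift
  window : ∀ r → r < K₂ → X ≤ N (K₁ + r) × N (K₁ + r) ≤ X + w
  window r r<K₂ with bounds (K₁ + r) (m≤m+n K₁ r) (+-monoʳ-< K₁ r<K₂)
  ... | lower , upper = lower , ≤-trans upper (m+n≤[m∸o]+[o+n] (N K₁) β₂ β₁)
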